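{- Let $\mathcal{G}$ be a growth order group whose growth rank $\mathrm{gr}(\mathcal{G})$ is finite with $n>0$ elements, and let $\mathcal{t}\in\mathcal{G}$ be scaling with $\mathrm{gr}(\mathcal{t})=\min\mathrm{gr}(\mathcal{G})$. If $\mathcal{C}(\mathcal{t})$ is Archimedean, then $n\leqslant 2$.
   Context: An ordered group is a group $(\mathcal{G},\cdot,1)$ with a linear order $<$ such that $g>h$ implies $fg>fh$ and $gf>hf$ for all $f$. $\mathcal{C}(g)=\{h: hg=gh\}$; $\mathcal{G}^{>}=\{f: f>1\}$. $f\preccurlyeq g$ holds if $f=1$, or if $g\neq 1$ and there are $g_0,g_1\in\mathcal{C}(g)$ with $g_0\leqslant f\leqslant g_1$; $f\asymp g$ iff $f\preccurlyeq g$ and $g\preccurlyeq f$; $f\prec g$ iff $f\preccurlyeq g$ and not $g\preccurlyeq f$; for $g,h\neq1$, $g\sim h$ iff $gh^{ -1}\prec g$. $\mathcal{s}\in\mathcal{G}^{>}$ is scaling if $\mathcal{C}(\mathcal{s})$ is Abelian and every $f\asymp\mathcal{s}$ has some $g\in\mathcal{C}(\mathcal{s})\setminus\{1\}$ with $g\sim f$. A growth order group is an ordered group with (GOG1) for $f,g\in\mathcal{G}^{>}$ with $f\geqslant g$ and $g_0\in\mathcal{C}(g)$ there is $f_0\in\mathcal{C}(f)$ with $f_0\geqslant g_0$; (GOG2) for $f,g\in\mathcal{G}^{>}$, if $f>\mathcal{C}(g)$ then $fg>gf$; (GOG3) every $f\neq 1$ has a scaling $\mathcal{s}\asymp f$.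 $\mathrm{gr}(f)$ is the $\asymp$-class of $f\neq1$; $\mathrm{gr}(\mathcal{G})$ is the set of these classes, ordered by $\mathrm{gr}(g)<\mathrm{gr}(h)$ iff $g\prec h$. An ordered group is Archimedean if for all non-identity $f,g$ there is $n\in\mathbb{Z}$ with $f^n\geqslant g$. -}

module Defs where

open import Level using (Level; suc; _⊔_)
open import Data.Nat using (ℕ; zero) renaming (suc to sucℕ)
open import Data.Integer using (ℤ; +_; -[1+_])
open import Data.Fin using (Fin)
open import Data.Product using (Σ; ∃; _×_; _,_)
open import Data.Sum using (_⊎_)
open import Relation.Nullary using (¬_)
open import Relation.Binary.PropositionalEquality using (_≡_; _≢_)
open import Relation.Binary.Definitions using (Transitive; Trichotomous)

record OrderedGroup (c ℓ : Level) : Set (Level.suc (c ⊔ ℓ)) where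
  infixl 7 _·_
  infix 4 _<_
  field
    Carrier : Set c
    _·_     : Carrier → Carrier → Carrier
    one     : Carrier
    _⁻¹     : Carrier → Carrier
    assoc   : ∀ x y z → (x · y) · z ≡ x · (y · z)
    identityˡ : ∀ x → one · x ≡ x
    identityʳ : ∀ x → x · one ≡ x
    inverseˡ  : ∀ x → (x ⁻¹) · x ≡ one
    inverseʳ  : ∀ x → x · (x ⁻¹) ≡ one
    _<_     : Carrier → Carrier → Set ℓ
    <-trans : Transitive _<_
    <-tri   : Trichotomous _≡_ _<_
    mono-<ˡ : ∀ f {g h} → h < g → f · h < f · g
    mono-<ʳ : ∀ f {g h} → h < g → h · f < g · f

module OG {c ℓ} (G : OrderedGroup c ℓ) where
  open OrderedGroup G public

  _≤_ : Carrier → Carrier → Set (c ⊔ ℓ)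
  x ≤ y = x < y ⊎ x ≡ y

  C : Carrier → Carrier → Set c
  C g h = h · g ≡ g · h

  _≼_ : Carrier → Carrier → Set (c ⊔ ℓ)
  f ≼ g = f ≡ one ⊎ (g ≢ one × Σ Carrier λ g₀ → Σ Carrier λ g₁ →
            C g g₀ × C g g₁ × g₀ ≤ f × f ≤ g₁)

  _≍_ : Carrier → Carrier → Set (c ⊔ ℓ)
  f ≍ g = f ≼ g × g ≼ f

  _≺_ : Carrier → Carrier → Set (c ⊔ ℓ)
  f ≺ g = f ≼ g × ¬ (g ≼ f)

  -- g ∼ h  (meaningful for g, h ≠ 1)
  _∼_ : Carrier → Carrier → Set (c ⊔ ℓ)
  g ∼ h = (g · (h ⁻¹)) ≺ g

  Scaling : Carrier → Set (c ⊔ ℓ)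
  Scaling s = one < s
            × (∀ a b → C s a → C s b → a · b ≡ b · a)
            × (∀ f → f ≍ s → Σ Carrier λ g → C s g × g ≢ one × g ∼ f)

  GOG1 : Set (c ⊔ ℓ)
  GOG1 = ∀ f g → one < f → one < g → g ≤ f →
         ∀ g₀ → C g g₀ → Σ Carrier λ f₀ → C f f₀ × g₀ ≤ f₀

  GOG2 : Set (c ⊔ ℓ)
  GOG2 = ∀ f g → one < f → one < g → (∀ h → C g h → h < f) → g · f < f · g

  GOG3 : Set (c ⊔ ℓ)
  GOG3 = ∀ f → f ≢ one → Σ Carrier λ s → Scaling s × s ≍ f

  IsGrowthOrderGroup : Set (c ⊔ ℓ)
  IsGrowthOrderGroup = GOG1 × GOG2 × GOG3

  powℕ : Carrier → ℕ → Carrier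
  powℕ f zero = one
  powℕ f (sucℕ n) = f · powℕ f n

  powℤ : Carrier → ℤ → Carrier
  powℤ f (+ n) = powℕ f n
  powℤ f -[1+ n ] = powℕ (f ⁻¹) (sucℕ n)

  CentraliserArchimedean : Carrier → Set (c ⊔ ℓ)
  CentraliserArchimedean t = ∀ f g → C t f → C t g → f ≢ one → g ≢ one →
                             Σ ℤ λ k → g ≤ powℤ f k

  -- gr(𝒢) has exactly n elements: representatives r i ≠ 1 of pairwise
  -- distinct ≍-classes that together exhaust all non-identity elements.
  GrowthRankHasSize : ℕ → Set (c ⊔ ℓ)
  GrowthRankHasSize n = Σ (Fin n → Carrier) λ r →
      (∀ i → r i ≢ one)
    × (∀ i j → r i ≍ r j → i ≡ j)
    × (∀ f → f ≢ one → Σ (Fin n) λ i → f ≍ r i)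

  -- gr(t) = min gr(𝒢): gr(t) ≤ gr(f) for every f ≠ 1
  GrowthMinimal : Carrier → Set (c ⊔ ℓ)
  GrowthMinimal t = ∀ f → f ≢ one → t ≺ f ⊎ t ≍ f

-- Write 𝒞 for 𝒞(t). As 𝒞 is Archimedean, each of its elements lies between two powers of t,
-- so it is ≼ everything of growth rank at least gr(t). Comparing, by the scaling property, an
-- element h ≍ t with some g ∈ 𝒞 then shows h ∈ 𝒞, and by minimality of gr(t) every a ≼ t lies
-- in 𝒞. Hence every x > 1 outside 𝒞 lies above 𝒞, so by (GOG2) conjugation by x shrinks t; it
-- also maps 𝒞 into itself. For such an f the conjugates f⁻ⁿ t fⁿ eventually fall below every
-- positive element of 𝒞, which forces the powers of f to be cofinal in 𝒢: all elements outside
-- 𝒞 share the largest growth rank. Since 𝒞 is Abelian, its non-identity elements share one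
-- growth rank too, so gr(𝒢) has at most two elements.

module Submission where

open import Algebra.Bundles using (Group)
import Algebra.Properties.Group as GroupProperties
open import Data.Fin using (Fin; zero; suc)
open import Data.Fin.Properties using (injective⇒≤)
open import Data.Integer using (+_; -[1+_])
open import Data.Nat using (ℕ; zero; suc)
open import Data.Product using (Σ; _×_; _,_; proj₁; proj₂)
open import Data.Sum using (_⊎_; inj₁; inj₂)
open import Function using (_∘_)
open import Level using (_⊔_)
open import Relation.Binary.Bundles using (StrictPartialOrder)
open import Relation.Binary.Consequences using (tri⇒irr; tri⇒dec≈)
import Relation.Binary.Construct.StrictToNonStrict as StrictToNonStrict
open import Relation.Binary.Definitions using (Decidable; Transitive; tri<; tri≈; tri>)
open import Relation.Binary.PropositionalEquality
import Relation.Binary.Reasoning.StrictPartialOrder as StrictPartialOrderReasoning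
open import Relation.Nullary using (¬_; Dec; yes; no; contradiction)

open import Defs

module OrderedGroupProperties {c ℓ} (G : OrderedGroup c ℓ) where
  -- OG._≤_ comes without a fixity declaration, so it would bind tighter than _·_.
  open OG G renaming (_≤_ to infix 4 _≤_)

  group : Group c c
  group = record
    { Carrier = Carrier
    ; _≈_ = _≡_
    ; _∙_ = _·_
    ; ε = one
    ; _⁻¹ = _⁻¹
    ; isGroup = record
      { isMonoid = record
        { isSemigroup = record
          { isMagma = record { isEquivalence = isEquivalence ; ∙-cong = cong₂ _·_ }
          ; assoc = assoc
          }
        ; identity = identityˡ , identityʳ
        }
      ; inverse = inverseˡ , inverseʳ
      ; ⁻¹-cong = cong _⁻¹
      }
    }

  open GroupProperties group public
    using ( ⁻¹-involutive; ⁻¹-anti-homo-∙; ε⁻¹≈ε; inverseʳ-unique; x∙y⁻¹≈ε⇒x≈y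
          ; \\-leftDividesˡ; \\-leftDividesʳ; //-rightDividesˡ; //-rightDividesʳ)

  <-strictPartialOrder : StrictPartialOrder c c ℓ
  <-strictPartialOrder = record
    { isStrictPartialOrder = record
      { isEquivalence = isEquivalence
      ; irrefl = tri⇒irr <-tri
      ; trans = <-trans
      ; <-resp-≈ = resp₂ _<_
      }
    }

  module ≤-Reasoning = StrictPartialOrderReasoning <-strictPartialOrder

  open StrictToNonStrict _≡_ _<_ public using (<⇒≤)

  ≤-trans : Transitive _≤_
  ≤-trans = StrictToNonStrict.trans _≡_ _<_ isEquivalence (resp₂ _<_) <-trans

  ≤-<-trans : ∀ {x y z} → x ≤ y → y < z → x < z
  ≤-<-trans = StrictToNonStrict.≤-<-trans _≡_ _<_ sym <-trans (respˡ _<_)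

  <-irrefl : ∀ {x} → ¬ x < x
  <-irrefl = tri⇒irr <-tri refl

  one<⇒≢one : ∀ {x} → one < x → x ≢ one
  one<⇒≢one one<x refl = <-irrefl one<x

  <⊎≥ : ∀ x y → x < y ⊎ y ≤ x
  <⊎≥ x y with <-tri x y
  ... | tri< x<y _ _ = inj₁ x<y
  ... | tri≈ _ x≡y _ = inj₂ (inj₂ (sym x≡y))
  ... | tri> _ _ y<x = inj₂ (inj₁ y<x)

  infix 4 _≟_
  _≟_ : Decidable {A = Carrier} _≡_
  _≟_ = tri⇒dec≈ <-tri

  ·-monoˡ-≤ : ∀ f {g h} → h ≤ g → f · h ≤ f · g
  ·-monoˡ-≤ f (inj₁ h<g) = inj₁ (mono-<ˡ f h<g)
  ·-monoˡ-≤ f (inj₂ refl) = inj₂ refl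

  ·-monoʳ-≤ : ∀ f {g h} → h ≤ g → h · f ≤ g · f
  ·-monoʳ-≤ f (inj₁ h<g) = inj₁ (mono-<ʳ f h<g)
  ·-monoʳ-≤ f (inj₂ refl) = inj₂ refl

  ·-mono-≤ : ∀ {a b c d} → a ≤ b → c ≤ d → a · c ≤ b · d
  ·-mono-≤ {a} {d = d} a≤b c≤d = ≤-trans (·-monoˡ-≤ a c≤d) (·-monoʳ-≤ d a≤b)

  ⁻¹-anti-< : ∀ {x y} → x < y → y ⁻¹ < x ⁻¹
  ⁻¹-anti-< {x} {y} x<y = begin-strict
    y ⁻¹             ≡⟨ //-rightDividesʳ x (y ⁻¹) ⟨
    y ⁻¹ · x · x ⁻¹  <⟨ mono-<ʳ (x ⁻¹) (mono-<ˡ (y ⁻¹) x<y) ⟩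
    y ⁻¹ · y · x ⁻¹  ≡⟨ cong (_· x ⁻¹) (inverseˡ y) ⟩
    one · x ⁻¹       ≡⟨ identityˡ (x ⁻¹) ⟩
    x ⁻¹             ∎
    where open ≤-Reasoning

  ⁻¹-anti-≤ : ∀ {x y} → x ≤ y → y ⁻¹ ≤ x ⁻¹
  ⁻¹-anti-≤ (inj₁ x<y) = inj₁ (⁻¹-anti-< x<y)
  ⁻¹-anti-≤ (inj₂ refl) = inj₂ refl

  <one⇒one<⁻¹ : ∀ {x} → x < one → one < x ⁻¹
  <one⇒one<⁻¹ x<one = subst (_< _) ε⁻¹≈ε (⁻¹-anti-< x<one)

  one≤⇒⁻¹≤one : ∀ {x} → one ≤ x → x ⁻¹ ≤ one
  one≤⇒⁻¹≤one one≤x = subst (_ ≤_) ε⁻¹≈ε (⁻¹-anti-≤ one≤x)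

  powℕ-one : ∀ n → powℕ one n ≡ one
  powℕ-one zero = refl
  powℕ-one (suc n) = trans (identityˡ _) (powℕ-one n)

  powℕ-monoˡ-≤ : ∀ {a b} → a ≤ b → ∀ n → powℕ a n ≤ powℕ b n
  powℕ-monoˡ-≤ a≤b zero = inj₂ refl
  powℕ-monoˡ-≤ a≤b (suc n) = ·-mono-≤ a≤b (powℕ-monoˡ-≤ a≤b n)

  one≤⇒one≤powℕ : ∀ {a} → one ≤ a → ∀ n → one ≤ powℕ a n
  one≤⇒one≤powℕ {a} one≤a n = subst (_≤ powℕ a n) (powℕ-one n) (powℕ-monoˡ-≤ one≤a n)

  powℤ≤powℕ : ∀ {f} → one ≤ f → ∀ k → Σ ℕ λ m → powℤ f k ≤ powℕ f m
  powℤ≤powℕ one≤f (+ n) = n , inj₂ refl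
  powℤ≤powℕ {f} one≤f -[1+ n ] =
    0 , subst (powℤ f -[1+ n ] ≤_) (powℕ-one (suc n)) (powℕ-monoˡ-≤ (one≤⇒⁻¹≤one one≤f) (suc n))

  C-one : ∀ {g} → C g one
  C-one {g} = trans (identityˡ g) (sym (identityʳ g))

  C-· : ∀ {g x y} → C g x → C g y → C g (x · y)
  C-· {g} {x} {y} gx≡xg gy≡yg = begin
    x · y · g    ≡⟨ assoc x y g ⟩
    x · (y · g)  ≡⟨ cong (x ·_) gy≡yg ⟩
    x · (g · y)  ≡⟨ assoc x g y ⟨
    x · g · y    ≡⟨ cong (_· y) gx≡xg ⟩
    g · x · y    ≡⟨ assoc g x y ⟩
    g · (x · y)  ∎
    where open ≡-Reasoning

  C-⁻¹ : ∀ {g x} → C g x → C g (x ⁻¹)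
  C-⁻¹ {g} {x} xg≡gx = begin
    x ⁻¹ · g                ≡⟨ //-rightDividesʳ x (x ⁻¹ · g) ⟨
    x ⁻¹ · g · x · x ⁻¹     ≡⟨ cong (_· x ⁻¹) (assoc (x ⁻¹) g x) ⟩
    x ⁻¹ · (g · x) · x ⁻¹   ≡⟨ cong (λ u → x ⁻¹ · u · x ⁻¹) xg≡gx ⟨
    x ⁻¹ · (x · g) · x ⁻¹   ≡⟨ cong (_· x ⁻¹) (\\-leftDividesʳ x g) ⟩
    g · x ⁻¹                ∎
    where open ≡-Reasoning

  C-powℕ : ∀ {g x} → C g x → ∀ n → C g (powℕ x n)
  C-powℕ x∈C zero = C-one
  C-powℕ x∈C (suc n) = C-· x∈C (C-powℕ x∈C n)

  powℕ-distrib : ∀ {a b} → a · b ≡ b · a → ∀ n → powℕ (a · b) n ≡ powℕ a n · powℕ b n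
  powℕ-distrib {a} {b} ab≡ba zero = sym (identityˡ one)
  powℕ-distrib {a} {b} ab≡ba (suc n) = begin
    a · b · powℕ (a · b) n        ≡⟨ cong (a · b ·_) (powℕ-distrib ab≡ba n) ⟩
    a · b · (aⁿ · bⁿ)             ≡⟨ assoc a b (aⁿ · bⁿ) ⟩
    a · (b · (aⁿ · bⁿ))           ≡⟨ cong (a ·_) (assoc b aⁿ bⁿ) ⟨
    a · (b · aⁿ · bⁿ)             ≡⟨ cong (λ u → a · (u · bⁿ)) (C-powℕ ab≡ba n) ⟨
    a · (aⁿ · b · bⁿ)             ≡⟨ cong (a ·_) (assoc aⁿ b bⁿ) ⟩
    a · (aⁿ · (b · bⁿ))           ≡⟨ assoc a aⁿ (b · bⁿ) ⟨
    a · aⁿ · (b · bⁿ)             ∎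
    where
    open ≡-Reasoning
    aⁿ bⁿ : Carrier
    aⁿ = powℕ a n
    bⁿ = powℕ b n

  conj : Carrier → Carrier → Carrier
  conj x a = x ⁻¹ · a · x

  conj-one : ∀ x → conj x one ≡ one
  conj-one x = trans (cong (_· x) (identityʳ (x ⁻¹))) (inverseˡ x)

  conj-by-one : ∀ a → conj one a ≡ a
  conj-by-one a = trans (identityʳ _) (trans (cong (_· a) ε⁻¹≈ε) (identityˡ a))

  conj-· : ∀ x a b → conj x (a · b) ≡ conj x a · conj x b
  conj-· x a b = begin
    x ⁻¹ · (a · b) · x                     ≡⟨ cong (λ u → x ⁻¹ · (a · u) · x) (\\-leftDividesˡ x b) ⟨
    x ⁻¹ · (a · (x · (x ⁻¹ · b))) · x      ≡⟨ cong (λ u → x ⁻¹ · u · x) (assoc a x (x ⁻¹ · b)) ⟨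
    x ⁻¹ · (a · x · (x ⁻¹ · b)) · x        ≡⟨ cong (_· x) (assoc (x ⁻¹) (a · x) (x ⁻¹ · b)) ⟨
    x ⁻¹ · (a · x) · (x ⁻¹ · b) · x        ≡⟨ cong (λ u → u · (x ⁻¹ · b) · x) (assoc (x ⁻¹) a x) ⟨
    conj x a · (x ⁻¹ · b) · x              ≡⟨ assoc (conj x a) (x ⁻¹ · b) x ⟩
    conj x a · conj x b                    ∎
    where open ≡-Reasoning

  conj-powℕ : ∀ x a n → conj x (powℕ a n) ≡ powℕ (conj x a) n
  conj-powℕ x a zero = conj-one x
  conj-powℕ x a (suc n) = trans (conj-· x a (powℕ a n)) (cong (conj x a ·_) (conj-powℕ x a n))

  conj-⁻¹ : ∀ x a → conj x (a ⁻¹) ≡ conj x a ⁻¹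
  conj-⁻¹ x a = inverseʳ-unique (conj x a) (conj x (a ⁻¹)) (begin
    conj x a · conj x (a ⁻¹)  ≡⟨ conj-· x a (a ⁻¹) ⟨
    conj x (a · a ⁻¹)         ≡⟨ cong (conj x) (inverseʳ a) ⟩
    conj x one                ≡⟨ conj-one x ⟩
    one                       ∎)
    where open ≡-Reasoning

  conj-comp : ∀ x y a → conj (x · y) a ≡ conj y (conj x a)
  conj-comp x y a = begin
    (x · y) ⁻¹ · a · (x · y)          ≡⟨ cong (λ u → u · a · (x · y)) (⁻¹-anti-homo-∙ x y) ⟩
    y ⁻¹ · x ⁻¹ · a · (x · y)         ≡⟨ assoc (y ⁻¹ · x ⁻¹ · a) x y ⟨
    y ⁻¹ · x ⁻¹ · a · x · y           ≡⟨ cong (λ u → u · x · y) (assoc (y ⁻¹) (x ⁻¹) a) ⟩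
    y ⁻¹ · (x ⁻¹ · a) · x · y         ≡⟨ cong (_· y) (assoc (y ⁻¹) (x ⁻¹ · a) x) ⟩
    y ⁻¹ · conj x a · y               ∎
    where open ≡-Reasoning

  conj-cancelˡ : ∀ x a → conj (x ⁻¹) (conj x a) ≡ a
  conj-cancelˡ x a = begin
    conj (x ⁻¹) (conj x a)  ≡⟨ conj-comp x (x ⁻¹) a ⟨
    conj (x · x ⁻¹) a       ≡⟨ cong (λ u → conj u a) (inverseʳ x) ⟩
    conj one a              ≡⟨ conj-by-one a ⟩
    a                       ∎
    where open ≡-Reasoning

  conj-cancelʳ : ∀ x a → conj x (conj (x ⁻¹) a) ≡ a
  conj-cancelʳ x a = subst (λ u → conj u (conj (x ⁻¹) a) ≡ a) (⁻¹-involutive x) (conj-cancelˡ (x ⁻¹) a)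

  conj-C : ∀ {a x} → C a x → conj x a ≡ a
  conj-C {a} {x} xa≡ax = begin
    x ⁻¹ · a · x    ≡⟨ assoc (x ⁻¹) a x ⟩
    x ⁻¹ · (a · x)  ≡⟨ cong (x ⁻¹ ·_) xa≡ax ⟨
    x ⁻¹ · (x · a)  ≡⟨ \\-leftDividesʳ x a ⟩
    a               ∎
    where open ≡-Reasoning

  conj-mono-< : ∀ x {a b} → a < b → conj x a < conj x b
  conj-mono-< x a<b = mono-<ʳ x (mono-<ˡ (x ⁻¹) a<b)

  conj-mono-≤ : ∀ x {a b} → a ≤ b → conj x a ≤ conj x b
  conj-mono-≤ x (inj₁ a<b) = inj₁ (conj-mono-< x a<b)
  conj-mono-≤ x (inj₂ refl) = inj₂ refl

  conj-one< : ∀ x {a} → one < a → one < conj x a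
  conj-one< x {a} one<a = subst (_< conj x a) (conj-one x) (conj-mono-< x one<a)

  PowerBounded : Carrier → Carrier → Set (c ⊔ ℓ)
  PowerBounded h a = (Σ ℕ λ m → a ≤ powℕ h m) × (Σ ℕ λ m → a ⁻¹ ≤ powℕ h m)

  PowerBounded-mono : ∀ {h h′ a} → h ≤ h′ → PowerBounded h a → PowerBounded h′ a
  PowerBounded-mono h≤h′ ((m , a≤hᵐ) , (m′ , a⁻¹≤hᵐ′)) =
    (m , ≤-trans a≤hᵐ (powℕ-monoˡ-≤ h≤h′ m)) , (m′ , ≤-trans a⁻¹≤hᵐ′ (powℕ-monoˡ-≤ h≤h′ m′))

  PowerBounded-conj : ∀ x {h a} → PowerBounded h a → PowerBounded (conj x h) (conj x a)
  PowerBounded-conj x {h} {a} ((m , a≤hᵐ) , (m′ , a⁻¹≤hᵐ′)) =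
    (m , subst (conj x a ≤_) (conj-powℕ x h m) (conj-mono-≤ x a≤hᵐ)) ,
    (m′ , subst₂ _≤_ (conj-⁻¹ x a) (conj-powℕ x h m′) (conj-mono-≤ x a⁻¹≤hᵐ′))

  PowerBounded⇒≼ : ∀ {d h a} → d ≢ one → C d h → PowerBounded h a → a ≼ d
  PowerBounded⇒≼ {h = h} {a} d≢one h∈C ((m , a≤hᵐ) , (m′ , a⁻¹≤hᵐ′)) =
    inj₂ (d≢one , powℕ h m′ ⁻¹ , powℕ h m , C-⁻¹ (C-powℕ h∈C m′) , C-powℕ h∈C m , lower , a≤hᵐ)
    where
    lower : powℕ h m′ ⁻¹ ≤ a
    lower = subst (powℕ h m′ ⁻¹ ≤_) (⁻¹-involutive a) (⁻¹-anti-≤ a⁻¹≤hᵐ′)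

module Growth {c ℓ} (G : OrderedGroup c ℓ) (gog2 : OG.GOG2 G) {t : OrderedGroup.Carrier G}
  (t-scaling : OG.Scaling G t) (t-minimal : OG.GrowthMinimal G t)
  (t-archimedean : OG.CentraliserArchimedean G t) where
  open OG G renaming (_≤_ to infix 4 _≤_)
  open OrderedGroupProperties G

  one<t : one < t
  one<t = proj₁ t-scaling

  t≢one : t ≢ one
  t≢one = one<⇒≢one one<t

  C-comm : ∀ {a b} → C t a → C t b → a · b ≡ b · a
  C-comm = proj₁ (proj₂ t-scaling) _ _

  C? : ∀ a → Dec (C t a)
  C? a = a · t ≟ t · a

  ≢one⇒t≼ : ∀ {a} → a ≢ one → t ≼ a
  ≢one⇒t≼ a≢one with t-minimal _ a≢one
  ... | inj₁ (t≼a , _) = t≼a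
  ... | inj₂ (t≼a , _) = t≼a

  C-below-powℕ : ∀ {f g} → C t f → one < f → C t g → Σ ℕ λ m → g ≤ powℕ f m
  C-below-powℕ {f} {g} f∈C one<f g∈C with g ≟ one
  ... | yes refl = 0 , inj₂ refl
  ... | no g≢one with t-archimedean f g f∈C g∈C (one<⇒≢one one<f) g≢one
  ...   | k , g≤fᵏ with powℤ≤powℕ (<⇒≤ one<f) k
  ...     | m , fᵏ≤fᵐ = m , ≤-trans g≤fᵏ fᵏ≤fᵐ

  C⇒PowerBounded : ∀ {a} → C t a → PowerBounded t a
  C⇒PowerBounded a∈C = C-below-powℕ refl one<t a∈C , C-below-powℕ refl one<t (C-⁻¹ a∈C)

  t≼⇒C-≼ : ∀ {g d} → t ≼ d → C t g → g ≼ d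
  t≼⇒C-≼ (inj₁ t≡one) g∈C = contradiction t≡one t≢one
  t≼⇒C-≼ (inj₂ (d≢one , _ , d₁ , _ , d₁∈C , _ , t≤d₁)) g∈C =
    PowerBounded⇒≼ d≢one d₁∈C (PowerBounded-mono t≤d₁ (C⇒PowerBounded g∈C))

  ≍t⇒C : ∀ {h} → h ≍ t → C t h
  ≍t⇒C {h} h≍t with proj₂ (proj₂ t-scaling) h h≍t
  ... | g , g∈C , _ , _ , g⋠gh⁻¹ with g · h ⁻¹ ≟ one
  ...   | yes gh⁻¹≡one = subst (C t) (x∙y⁻¹≈ε⇒x≈y g h gh⁻¹≡one) g∈C
  ...   | no gh⁻¹≢one = contradiction (t≼⇒C-≼ (≢one⇒t≼ gh⁻¹≢one) g∈C) g⋠gh⁻¹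

  ≼t⇒C : ∀ {a} → a ≼ t → C t a
  ≼t⇒C {a} a≼t with a ≟ one
  ... | yes refl = C-one
  ... | no a≢one = ≍t⇒C (a≼t , ≢one⇒t≼ a≢one)

  Above : Carrier → Set (c ⊔ ℓ)
  Above x = ∀ y → C t y → y < x

  Above⇒one< : ∀ {x} → Above x → one < x
  Above⇒one< above = above one C-one

  ¬C⇒Above : ∀ {x} → one < x → ¬ C t x → Above x
  ¬C⇒Above {x} one<x x∉C y y∈C with <⊎≥ y x
  ... | inj₁ y<x = y<x
  ... | inj₂ x≤y = contradiction (≼t⇒C (inj₂ (t≢one , one , y , C-one , y∈C , <⇒≤ one<x , x≤y))) x∉C

  Above⇒conj<t : ∀ {x} → Above x → conj x t < t
  Above⇒conj<t {x} above = begin-strict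
    x ⁻¹ · t · x    ≡⟨ assoc (x ⁻¹) t x ⟩
    x ⁻¹ · (t · x)  <⟨ mono-<ˡ (x ⁻¹) (gog2 x t (Above⇒one< above) one<t above) ⟩
    x ⁻¹ · (x · t)  ≡⟨ \\-leftDividesʳ x t ⟩
    t               ∎
    where open ≤-Reasoning

  one≤⇒conj≤t : ∀ {x} → one ≤ x → conj x t ≤ t
  one≤⇒conj≤t (inj₂ refl) = inj₂ (conj-by-one t)
  one≤⇒conj≤t {x} (inj₁ one<x) with C? x
  ... | yes x∈C = inj₂ (conj-C x∈C)
  ... | no x∉C = <⇒≤ (Above⇒conj<t (¬C⇒Above one<x x∉C))

  conj<t⇒one< : ∀ {y} → conj y t < t → one < y
  conj<t⇒one< {y} conj<t with <-tri one y
  ... | tri< one<y _ _ = one<y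
  ... | tri≈ _ refl _ = contradiction (subst (_< t) (conj-by-one t) conj<t) <-irrefl
  ... | tri> _ _ y<one = contradiction (≤-<-trans t≤conj conj<t) <-irrefl
    where
    t≤conj : t ≤ conj y t
    t≤conj = subst (_≤ conj y t) (conj-cancelʳ y t)
      (conj-mono-≤ y (one≤⇒conj≤t (<⇒≤ (<one⇒one<⁻¹ y<one))))

  C-conj : ∀ {x a} → one ≤ x → C t a → C t (conj x a)
  C-conj {x} one≤x a∈C = ≼t⇒C (PowerBounded⇒≼ t≢one refl
    (PowerBounded-mono (one≤⇒conj≤t one≤x) (PowerBounded-conj x (C⇒PowerBounded a∈C))))

  -- From t = (f⁻¹ t f) e with e ∈ 𝒞, e > 1 and t ≤ eʲ we get Tₙ = Tₙ₊₁ Eₙ and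
  -- Tₙ ≤ Eₙʲ, so every n with b ≤ Tₙ gives Tₙ₊₁ʲ b ≤ Tₙʲ. If this held for all n < M, then
  -- bᴹ ≤ tʲ, which fails for large M because 𝒞 is Archimedean.
  module Descent {f} (above : Above f) where
    one≤fⁿ : ∀ n → one ≤ powℕ f n
    one≤fⁿ = one≤⇒one≤powℕ (<⇒≤ (Above⇒one< above))

    T : ℕ → Carrier
    T n = conj (powℕ f n) t

    e : Carrier
    e = conj f t ⁻¹ · t

    E : ℕ → Carrier
    E n = conj (powℕ f n) e

    T∈C : ∀ n → C t (T n)
    T∈C n = C-conj (one≤fⁿ n) refl

    e∈C : C t e
    e∈C = C-· (C-⁻¹ (C-conj (<⇒≤ (Above⇒one< above)) refl)) refl

    E∈C : ∀ n → C t (E n)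
    E∈C n = C-conj (one≤fⁿ n) e∈C

    one<e : one < e
    one<e = subst (_< e) (inverseˡ (conj f t)) (mono-<ˡ (conj f t ⁻¹) (Above⇒conj<t above))

    T-split : ∀ n → T n ≡ T (suc n) · E n
    T-split n = begin
      conj fⁿ t                 ≡⟨ cong (conj fⁿ) (\\-leftDividesˡ (conj f t) t) ⟨
      conj fⁿ (conj f t · e)    ≡⟨ conj-· fⁿ (conj f t) e ⟩
      conj fⁿ (conj f t) · E n  ≡⟨ cong (_· E n) (conj-comp f fⁿ t) ⟨
      T (suc n) · E n           ∎
      where
      open ≡-Reasoning
      fⁿ : Carrier
      fⁿ = powℕ f n

    j : ℕ
    j = proj₁ (C-below-powℕ e∈C one<e refl)

    t≤eʲ : t ≤ powℕ e j
    t≤eʲ = proj₂ (C-below-powℕ e∈C one<e refl)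

    Tʲ-step : ∀ {b} n → b ≤ T n → powℕ (T (suc n)) j · b ≤ powℕ (T n) j
    Tʲ-step {b} n b≤Tₙ = begin
      powℕ (T (suc n)) j · b              ≤⟨ ·-monoˡ-≤ (powℕ (T (suc n)) j) (≤-trans b≤Tₙ Tₙ≤Eₙʲ) ⟩
      powℕ (T (suc n)) j · powℕ (E n) j   ≡⟨ powℕ-distrib (C-comm (T∈C (suc n)) (E∈C n)) j ⟨
      powℕ (T (suc n) · E n) j            ≡⟨ cong (λ u → powℕ u j) (T-split n) ⟨
      powℕ (T n) j                        ∎
      where
      open ≤-Reasoning
      Tₙ≤Eₙʲ : T n ≤ powℕ (E n) j
      Tₙ≤Eₙʲ = subst (T n ≤_) (conj-powℕ (powℕ f n) e j) (conj-mono-≤ (powℕ f n) t≤eʲ)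

    below-or-bounded : ∀ b M → (Σ ℕ λ i → T i < b) ⊎ (powℕ (T M) j · powℕ b M ≤ powℕ t j)
    below-or-bounded b zero = inj₂ (inj₂ (trans (identityʳ _) (cong (λ u → powℕ u j) (conj-by-one t))))
    below-or-bounded b (suc M) with below-or-bounded b M
    ... | inj₁ below = inj₁ below
    ... | inj₂ bounded with <⊎≥ (T M) b
    ...   | inj₁ Tₘ<b = inj₁ (M , Tₘ<b)
    ...   | inj₂ b≤Tₘ = inj₂ (begin
      powℕ (T (suc M)) j · (b · powℕ b M)  ≡⟨ assoc (powℕ (T (suc M)) j) b (powℕ b M) ⟨
      powℕ (T (suc M)) j · b · powℕ b M    ≤⟨ ·-monoʳ-≤ (powℕ b M) (Tʲ-step M b≤Tₘ) ⟩
      powℕ (T M) j · powℕ b M              ≤⟨ bounded ⟩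
      powℕ t j                             ∎)
      where open ≤-Reasoning

    eventually-below : ∀ {b} → C t b → one < b → Σ ℕ λ i → T i < b
    eventually-below {b} b∈C one<b with C-below-powℕ b∈C one<b (C-powℕ refl j)
    ... | k , tʲ≤bᵏ with below-or-bounded b (suc k)
    ...   | inj₁ below = below
    ...   | inj₂ bounded = contradiction bᵏ<bᵏ <-irrefl
      where
      open ≤-Reasoning
      one≤Tʲ : one ≤ powℕ (T (suc k)) j
      one≤Tʲ = one≤⇒one≤powℕ (<⇒≤ (conj-one< (powℕ f (suc k)) one<t)) j
      bᵏ<bᵏ : powℕ b k < powℕ b k
      bᵏ<bᵏ = begin-strict
        powℕ b k                                ≡⟨ identityˡ (powℕ b k) ⟨
        one · powℕ b k                          <⟨ mono-<ʳ (powℕ b k) one<b ⟩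
        powℕ b (suc k)                          ≡⟨ identityˡ (powℕ b (suc k)) ⟨
        one · powℕ b (suc k)                    ≤⟨ ·-monoʳ-≤ (powℕ b (suc k)) one≤Tʲ ⟩
        powℕ (T (suc k)) j · powℕ b (suc k)     ≤⟨ bounded ⟩
        powℕ t j                                ≤⟨ tʲ≤bᵏ ⟩
        powℕ b k                                ∎

  conj<conj⇒< : ∀ {x g} → conj x t < conj g t → g < x
  conj<conj⇒< {x} {g} conj-x<conj-g = begin-strict
    g              ≡⟨ identityˡ g ⟨
    one · g        <⟨ mono-<ʳ g (conj<t⇒one< conj<t) ⟩
    x · g ⁻¹ · g   ≡⟨ //-rightDividesˡ g x ⟩
    x              ∎
    where
    open ≤-Reasoning
    conj<t : conj (x · g ⁻¹) t < t
    conj<t = subst₂ _<_ (sym (conj-comp x (g ⁻¹) t)) (conj-cancelˡ g t) (conj-mono-< (g ⁻¹) conj-x<conj-g)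

  Above⇒cofinal : ∀ {f} → Above f → ∀ g → Σ ℕ λ m → g ≤ powℕ f m
  Above⇒cofinal above g with <⊎≥ one g
  ... | inj₂ g≤one = 0 , g≤one
  ... | inj₁ one<g with Descent.eventually-below above (C-conj (<⇒≤ one<g) refl) (conj-one< g one<t)
  ...   | i , Tᵢ<conj-g = i , <⇒≤ (conj<conj⇒< Tᵢ<conj-g)

  Above⇒PowerBounded : ∀ {f} → Above f → ∀ a → PowerBounded f a
  Above⇒PowerBounded above a = Above⇒cofinal above a , Above⇒cofinal above (a ⁻¹)

  ¬C⇒≢one : ∀ {b} → ¬ C t b → b ≢ one
  ¬C⇒≢one b∉C refl = b∉C C-one

  ¬C⇒≼ : ∀ {b} → ¬ C t b → ∀ a → a ≼ b
  ¬C⇒≼ {b} b∉C a with <-tri one b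
  ... | tri< one<b _ _ =
    PowerBounded⇒≼ (¬C⇒≢one b∉C) refl (Above⇒PowerBounded (¬C⇒Above one<b b∉C) a)
  ... | tri≈ _ refl _ = contradiction C-one b∉C
  ... | tri> _ _ b<one =
    PowerBounded⇒≼ (¬C⇒≢one b∉C) (C-⁻¹ refl) (Above⇒PowerBounded (¬C⇒Above (<one⇒one<⁻¹ b<one) b⁻¹∉C) a)
    where
    b⁻¹∉C : ¬ C t (b ⁻¹)
    b⁻¹∉C = b∉C ∘ subst (C t) (⁻¹-involutive b) ∘ C-⁻¹

  C-≼ : ∀ {a b} → C t a → C t b → b ≢ one → a ≼ b
  C-≼ {a} a∈C b∈C b≢one = inj₂ (b≢one , a , a , C-comm a∈C b∈C , C-comm a∈C b∈C , inj₂ refl , inj₂ refl)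

  side : Carrier → Fin 2
  side a with C? a
  ... | yes _ = zero
  ... | no _ = suc zero

  same-side⇒≍ : ∀ {a b} → a ≢ one → b ≢ one → side a ≡ side b → a ≍ b
  same-side⇒≍ {a} {b} a≢one b≢one _ with C? a | C? b
  ... | yes a∈C | yes b∈C = C-≼ a∈C b∈C b≢one , C-≼ b∈C a∈C a≢one
  ... | no a∉C | no b∉C = ¬C⇒≼ b∉C a , ¬C⇒≼ a∉C b
  same-side⇒≍ _ _ () | yes _ | no _
  same-side⇒≍ _ _ () | no _ | yes _

-- Imported only here: inside the modules above, _≤_ and _<_ denote the order of G.
open import Data.Nat using (_≤_; _<_)

proposition3p14 : ∀ {c ℓ} (G : OrderedGroup c ℓ) → OG.IsGrowthOrderGroup G →
    (n : ℕ) → 0 < n → OG.GrowthRankHasSize G n →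
    (t : OrderedGroup.Carrier G) → OG.Scaling G t → OG.GrowthMinimal G t →
    OG.CentraliserArchimedean G t → n ≤ 2
proposition3p14 G (_ , gog2 , _) n _ (r , r≢one , r-injective , _) t t-scaling t-minimal t-archimedean =
  injective⇒≤ (λ {i} {j} same → r-injective i j (same-side⇒≍ (r≢one i) (r≢one j) same))
  where open Growth G gog2 t-scaling t-minimal t-archimedean
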